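{- Let $n\ge1$. Then \[ \sum_{\lambda \vdash n}\sum_{\lambda_i \in \lambda}\Lambda(\lambda_i)=\sum_{\lambda \vdash n}\sum_{\substack{\lambda_i \in \lambda \\ \lambda_i \text{ distinct}}} \log(\lambda_i)=\sum_{k=1}^{n}p(n-k) \log k. \] Furthermore, $\prod_{k=1}^{n}k^{p(n-k)}=\prod_{\lambda\vdash n}\ \prod_{\lambda_i\in\lambda,\ \lambda_i\text{ distinct}}\lambda_i$, i.e. it equals the product of all distinct parts in every partition of $n$.
   Context: $\Lambda$ is the von Mangoldt function: $\Lambda(m)=\log p$ if $m$ is a positive integer power of a prime $p$, and $0$ otherwise. $\lambda\vdash n$ means $\lambda$ is a partition of $n$; $\sum_{\lambda_i\in\lambda}$ runs over all parts counted with multiplicity, while "distinct" sums/products run over the distinct part sizes of $\lambda$, each once. $p(m)$ is the number of partitions of $m$, with $p(0)=1$. -}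

module Defs where

open import Data.Nat using (ℕ; suc; _≤_; _≥_; _^_; _∸_; _≟_)
open import Data.Nat.Primality using (Prime)
open import Data.Nat.ListAction using (sum; product)
open import Data.List using (List; map; length; applyUpTo; deduplicate)
open import Data.List.Relation.Unary.All using (All)
open import Data.List.Relation.Unary.Linked using (Linked)
open import Data.List.Membership.Propositional using (_∈_)
open import Data.List.Relation.Unary.Unique.Propositional using (Unique)
open import Data.Product using (_×_; ∃₂)
open import Function.Bundles using (_⇔_)
open import Relation.Binary.PropositionalEquality using (_≡_)
open import Relation.Nullary using (¬_)

IsPartition : ℕ → List ℕ → Set
IsPartition m l = All (1 ≤_) l × Linked _≥_ l × sum l ≡ m

EnumeratesPartitions : (ℕ → List (List ℕ)) → Set
EnumeratesPartitions P = (∀ m l → (l ∈ P m) ⇔ IsPartition m l) × (∀ m → Unique (P m))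

-- E is exp ∘ Λ (exponential of the von Mangoldt function):
-- E (p ^ k) = p for p prime and k ≥ 1, and E m = 1 otherwise.
IsExpVonMangoldt : (ℕ → ℕ) → Set
IsExpVonMangoldt E =
  (∀ p k → Prime p → E (p ^ suc k) ≡ p) ×
  (∀ m → ¬ (∃₂ λ p k → Prime p × m ≡ p ^ suc k) → E m ≡ 1)

prodDistinct : List ℕ → ℕ
prodDistinct l = product (deduplicate _≟_ l)

prodExpΛ : (ℕ → List (List ℕ)) → (ℕ → ℕ) → ℕ → ℕ
prodExpΛ P E n = product (map (λ l → product (map E l)) (P n))

prodAllDistinct : (ℕ → List (List ℕ)) → ℕ → ℕ
prodAllDistinct P n = product (map prodDistinct (P n))

prodKPow : (ℕ → List (List ℕ)) → ℕ → ℕ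
prodKPow P n = product (map (λ k → k ^ length (P (n ∸ k))) (applyUpTo suc n))

module Submission where

-- Write p(m) for the number of partitions of m.  Both products are regrouped
-- by the value k ∈ [1..n] of the parts, so each becomes ∏ₖ (…)^(exponent k):
--
-- * Distinct parts.  The number of partitions of n having k as a part is
--   p(n - k): removing one copy of k is a bijection onto the partitions of
--   n - k, inverse to inserting k.  Hence ∏_λ ∏_{distinct} λᵢ = ∏ₖ k^p(n-k).
--
-- * Parts with multiplicity.  The total multiplicity S(k,n) of k over all
--   partitions of n satisfies S(k,k+r) = p(r) + S(k,r) (same bijection), as
--   does T(k,n) = Σ_{m ≤ n, k ∣ m} p(n - m); so S = T.  Exchanging the two
--   products and using ∏_{d ∣ m} exp Λ(d) = m (log m = Σ_{d∣m} Λ(d)) gives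
--   ∏_λ ∏ᵢ exp Λ(λᵢ) = ∏ₖ exp Λ(k)^T(k,n) = ∏ₘ m^p(n-m).

open import Defs
open import Data.Nat
  using (ℕ; zero; suc; _+_; _*_; _∸_; _^_; _≤_; _<_; _≥_; z≤n; s≤s; _≟_; _≤?_; nonTrivial⇒n>1; >-nonZero)
open import Data.Nat.Properties
open import Data.Nat.Divisibility
  using (_∣_; _∣?_; divides; ∣-refl; ∣-trans; ∣⇒≤; 1∣_; ∣1⇒≡1; *-monoʳ-∣; *-cancelˡ-∣;
         ∣m+n∣m⇒∣n; ∣m∣n⇒∣m+n; m∣m*n; n∣m*n)
open import Data.Nat.Coprimality using (Coprime; coprime-divisor)
open import Data.Nat.Primality
  using (Prime; ¬prime[1]; prime⇒irreducible; euclidsLemma; prime⇒nonZero; prime⇒nonTrivial)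
open import Data.Nat.Primality.Factorisation using (factorise)
open import Data.Nat.Induction using (<-rec)
open import Data.Nat.ListAction using (sum; product)
open import Data.Nat.ListAction.Properties using (sum-↭)
open import Data.List using (List; []; _∷_; _++_; [_]; map; length; applyUpTo; filter; deduplicate)
open import Data.List.Properties using (length-map; map-id; applyUpTo-∷ʳ)
open import Data.List.Relation.Unary.All using (All; []; _∷_)
import Data.List.Relation.Unary.All as All
open import Data.List.Relation.Unary.All.Properties using () renaming (map⁺ to All-map⁺)
open import Data.List.Relation.Unary.Any using (here; there)
open import Data.List.Relation.Unary.Linked using (Linked; []; [-]; _∷_)
import Data.List.Relation.Unary.Linked as Linked
open import Data.List.Relation.Unary.AllPairs using ([]; _∷_)
open import Data.List.Relation.Unary.Unique.Propositional using (Unique)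
import Data.List.Relation.Unary.Unique.Propositional.Properties as Unique
open import Data.List.Relation.Unary.Unique.DecPropositional.Properties _≟_ using (deduplicate-!)
open import Data.List.Relation.Unary.Sorted.TotalOrder.Properties using (↗↭↗⇒≋)
open import Data.List.Relation.Binary.Equality.Propositional using (≋⇒≡)
open import Data.List.Relation.Binary.Permutation.Propositional
  using (_↭_; ↭-refl; ↭-prep; ↭-swap; ↭-sym; ↭-trans; ↭-reflexive; ↭⇒↭ₛ)
import Data.List.Relation.Binary.Permutation.Propositional.Properties as Perm
open import Data.List.Relation.Binary.BagAndSetEquality using (∼bag⇒↭)
open import Data.List.Membership.Propositional using (_∈_; _∉_)
open import Data.List.Membership.DecPropositional _≟_ using (_∈?_)
open import Data.List.Membership.Propositional.Properties
  using (∈-filter⁺; ∈-filter⁻; ∈-map⁺; ∈-map⁻; ∈-deduplicate⁺; ∈-deduplicate⁻; ∈-applyUpTo⁺; ∈-applyUpTo⁻)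
open import Data.List.Membership.Propositional.Properties.WithK using (unique∧set⇒bag)
open import Data.List.Sort.InsertionSort.Base using (insert)
import Data.List.Sort.InsertionSort.Properties as InsertionSort
open import Data.Product using (_×_; _,_; proj₁; proj₂; ∃; ∃₂)
open import Data.Sum using (inj₁; inj₂)
open import Function.Bundles using (mk⇔; Equivalence)
open import Relation.Binary.Bundles using (DecTotalOrder)
import Relation.Binary.Construct.Flip.EqAndOrd as Flip
open import Relation.Binary.Definitions using (tri<; tri≈; tri>)
open import Relation.Nullary using (¬_; Dec; yes; no; contradiction)
open import Relation.Nullary.Decidable using (_×-dec_; ¬?)
open import Relation.Unary using (Decidable)
open import Relation.Binary.PropositionalEquality
  using (_≡_; _≢_; refl; sym; trans; cong; cong₂; subst; module ≡-Reasoning)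
open import Algebra.Properties.CommutativeSemigroup +-commutativeSemigroup using (x∙yz≈y∙xz)

private
  variable
    A B : Set

𝟙 : Dec A → ℕ
𝟙 (yes _) = 1
𝟙 (no _)  = 0

𝟙-yes : (a : Dec A) → A → 𝟙 a ≡ 1
𝟙-yes (yes _) _ = refl
𝟙-yes (no ¬a) a = contradiction a ¬a

𝟙-no : (a : Dec A) → ¬ A → 𝟙 a ≡ 0
𝟙-no (yes a) ¬a = contradiction a ¬a
𝟙-no (no _)  _  = refl

𝟙-⇔ : (A → B) → (B → A) → (a : Dec A) (b : Dec B) → 𝟙 a ≡ 𝟙 b
𝟙-⇔ f g (yes _) (yes _) = refl
𝟙-⇔ f g (yes a) (no ¬b) = contradiction (f a) ¬b
𝟙-⇔ f g (no ¬a) (yes b) = contradiction (g b) ¬a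
𝟙-⇔ f g (no _)  (no _)  = refl

𝟙-split : (B → A) → (a : Dec A) (b : Dec B) → 𝟙 a ≡ 𝟙 b + 𝟙 (a ×-dec ¬? b)
𝟙-split _   (yes _) (yes _) = refl
𝟙-split _   (yes _) (no _)  = refl
𝟙-split b⇒a (no ¬a) (yes b) = contradiction (b⇒a b) ¬a
𝟙-split _   (no _)  (no _)  = refl

∣⇒≤′ : ∀ {k m} → 1 ≤ m → k ∣ m → k ≤ m
∣⇒≤′ 1≤m = ∣⇒≤ ⦃ >-nonZero 1≤m ⦄

∑ : List A → (A → ℕ) → ℕ
∑ xs f = sum (map f xs)

∏ : List A → (A → ℕ) → ℕ
∏ xs f = product (map f xs)

∑-cong : (xs : List A) {f g : A → ℕ} → (∀ x → x ∈ xs → f x ≡ g x) → ∑ xs f ≡ ∑ xs g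
∑-cong []       h = refl
∑-cong (x ∷ xs) h = cong₂ _+_ (h x (here refl)) (∑-cong xs (λ y y∈ → h y (there y∈)))

∏-cong : (xs : List A) {f g : A → ℕ} → (∀ x → x ∈ xs → f x ≡ g x) → ∏ xs f ≡ ∏ xs g
∏-cong []       h = refl
∏-cong (x ∷ xs) h = cong₂ _*_ (h x (here refl)) (∏-cong xs (λ y y∈ → h y (there y∈)))

∑-zero : (xs : List A) {f : A → ℕ} → (∀ x → x ∈ xs → f x ≡ 0) → ∑ xs f ≡ 0
∑-zero []       h = refl
∑-zero (x ∷ xs) h = cong₂ _+_ (h x (here refl)) (∑-zero xs (λ y y∈ → h y (there y∈)))

∏-one : (xs : List A) {f : A → ℕ} → (∀ x → x ∈ xs → f x ≡ 1) → ∏ xs f ≡ 1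
∏-one []       h = refl
∏-one (x ∷ xs) h = cong₂ _*_ (h x (here refl)) (∏-one xs (λ y y∈ → h y (there y∈)))

∑-++ : (xs ys : List A) (f : A → ℕ) → ∑ (xs ++ ys) f ≡ ∑ xs f + ∑ ys f
∑-++ []       ys f = refl
∑-++ (x ∷ xs) ys f = trans (cong (f x +_) (∑-++ xs ys f)) (sym (+-assoc (f x) _ _))

∑-↭ : {xs ys : List A} (f : A → ℕ) → xs ↭ ys → ∑ xs f ≡ ∑ ys f
∑-↭ f xs↭ys = sum-↭ (Perm.map⁺ f xs↭ys)

∑-𝟙 : {P : A → Set} (P? : Decidable P) (xs : List A) → ∑ xs (λ x → 𝟙 (P? x)) ≡ length (filter P? xs)
∑-𝟙 P? []       = refl
∑-𝟙 P? (x ∷ xs) with P? x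
... | yes _ = cong suc (∑-𝟙 P? xs)
... | no _  = ∑-𝟙 P? xs

∑-filter : {P : A → Set} (P? : Decidable P) (xs : List A) (f : A → ℕ) →
  (∀ x → ¬ P x → f x ≡ 0) → ∑ xs f ≡ ∑ (filter P? xs) f
∑-filter P? []       f f≡0 = refl
∑-filter P? (x ∷ xs) f f≡0 with P? x
... | yes _  = cong (f x +_) (∑-filter P? xs f f≡0)
... | no ¬px = trans (cong (_+ ∑ xs f) (f≡0 x ¬px)) (∑-filter P? xs f f≡0)

∏-* : (xs : List A) (f g : A → ℕ) → ∏ xs (λ x → f x * g x) ≡ ∏ xs f * ∏ xs g
∏-* []       f g = refl
∏-* (x ∷ xs) f g = trans (cong (f x * g x *_) (∏-* xs f g))
                         ([m*n]*[o*p]≡[m*o]*[n*p] (f x) (g x) (∏ xs f) (∏ xs g))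

∏-swap : (xs : List A) (ys : List B) (h : A → B → ℕ) →
  ∏ xs (λ x → ∏ ys (h x)) ≡ ∏ ys (λ y → ∏ xs (λ x → h x y))
∏-swap []       ys h = sym (∏-one ys (λ _ _ → refl))
∏-swap (x ∷ xs) ys h = trans (cong (∏ ys (h x) *_) (∏-swap xs ys h))
                             (sym (∏-* ys (h x) (λ y → ∏ xs (λ x → h x y))))

∏-^-exponent : (xs : List A) (c : ℕ) (e : A → ℕ) → ∏ xs (λ x → c ^ e x) ≡ c ^ ∑ xs e
∏-^-exponent []       c e = refl
∏-^-exponent (x ∷ xs) c e = trans (cong (c ^ e x *_) (∏-^-exponent xs c e))
                                  (sym (^-distribˡ-+-* c (e x) (∑ xs e)))

∏-^-base : (xs : List A) (f : A → ℕ) (k : ℕ) → ∏ xs (λ x → f x ^ k) ≡ ∏ xs f ^ k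
∏-^-base xs f zero    = ∏-one xs (λ _ _ → refl)
∏-^-base xs f (suc k) = trans (∏-* xs f (λ x → f x ^ k)) (cong (∏ xs f *_) (∏-^-base xs f k))

∏-single : (xs : List A) {f : A → ℕ} {x : A} → Unique xs → x ∈ xs →
  (∀ y → y ∈ xs → y ≢ x → f y ≡ 1) → ∏ xs f ≡ f x
∏-single (y ∷ ys) {f} (y∉ys ∷ _) (here refl) h =
  trans (cong (f y *_) (∏-one ys (λ z z∈ → h z (there z∈) (λ z≡y → All.lookup y∉ys z∈ (sym z≡y)))))
        (*-identityʳ (f y))
∏-single (y ∷ ys) {f} {x} (y∉ys ∷ u) (there x∈) h =
  trans (cong₂ _*_ (h y (here refl) (All.lookup y∉ys x∈)) (∏-single ys u x∈ (λ z z∈ → h z (there z∈))))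
        (*-identityˡ (f x))

unique-map : {f : A → B} (xs : List A) → (∀ {x y} → x ∈ xs → y ∈ xs → f x ≡ f y → x ≡ y) →
  Unique xs → Unique (map f xs)
unique-map []       inj []            = []
unique-map (x ∷ xs) inj (x∉xs ∷ u) =
  All-map⁺ (All.tabulate λ y∈ fx≡fy → All.lookup x∉xs y∈ (inj (here refl) (there y∈) fx≡fy))
  ∷ unique-map xs (λ x∈ y∈ → inj (there x∈) (there y∈)) u

mult : ℕ → List ℕ → ℕ
mult k xs = ∑ xs (λ x → 𝟙 (k ≟ x))

mult-∉ : ∀ k xs → k ∉ xs → mult k xs ≡ 0
mult-∉ k xs k∉xs = ∑-zero xs (λ x x∈ → 𝟙-no (k ≟ x) (λ { refl → k∉xs x∈ }))

mult-unique-∈ : ∀ {k xs} → Unique xs → k ∈ xs → mult k xs ≡ 1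
mult-unique-∈ {k} {x ∷ xs} (x∉xs ∷ _) (here refl) =
  cong₂ _+_ (𝟙-yes (k ≟ k) refl) (mult-∉ k xs (λ k∈ → All.lookup x∉xs k∈ refl))
mult-unique-∈ {k} {x ∷ xs} (x∉xs ∷ u) (there k∈) =
  cong₂ _+_ (𝟙-no (k ≟ x) (λ { refl → All.lookup x∉xs k∈ refl })) (mult-unique-∈ u k∈)

mult-deduplicate : ∀ k l → mult k (deduplicate _≟_ l) ≡ 𝟙 (k ∈? l)
mult-deduplicate k l with k ∈? l
... | yes k∈l = mult-unique-∈ (deduplicate-! l) (∈-deduplicate⁺ _≟_ k∈l)
... | no k∉l  = mult-∉ k (deduplicate _≟_ l) (λ k∈ → k∉l (∈-deduplicate⁻ _≟_ l k∈))

∏-by-multiplicity : (K xs : List ℕ) (f : ℕ → ℕ) → Unique K → (∀ x → x ∈ xs → x ∈ K) →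
  ∏ xs f ≡ ∏ K (λ k → f k ^ mult k xs)
∏-by-multiplicity K []       f u cover = sym (∏-one K (λ _ _ → refl))
∏-by-multiplicity K (x ∷ xs) f u cover = begin
    f x * ∏ xs f
  ≡⟨ cong₂ _*_ (sym (trans (∏-single K u (cover x (here refl)) others) atX))
               (∏-by-multiplicity K xs f u (λ y y∈ → cover y (there y∈))) ⟩
    ∏ K (λ k → f k ^ 𝟙 (k ≟ x)) * ∏ K (λ k → f k ^ mult k xs)
  ≡⟨ sym (∏-* K _ _) ⟩
    ∏ K (λ k → f k ^ 𝟙 (k ≟ x) * f k ^ mult k xs)
  ≡⟨ ∏-cong K (λ k _ → sym (^-distribˡ-+-* (f k) (𝟙 (k ≟ x)) (mult k xs))) ⟩
    ∏ K (λ k → f k ^ mult k (x ∷ xs)) ∎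
  where
  open ≡-Reasoning
  others : ∀ y → y ∈ K → y ≢ x → f y ^ 𝟙 (y ≟ x) ≡ 1
  others y _ y≢x = cong (f y ^_) (𝟙-no (y ≟ x) y≢x)
  atX : f x ^ 𝟙 (x ≟ x) ≡ f x
  atX = trans (cong (f x ^_) (𝟙-yes (x ≟ x) refl)) (*-identityʳ (f x))

∏∏-by-multiplicity : (K : List ℕ) (L : List A) (g : A → List ℕ) (f : ℕ → ℕ) → Unique K →
  (∀ l → l ∈ L → ∀ x → x ∈ g l → x ∈ K) →
  ∏ L (λ l → ∏ (g l) f) ≡ ∏ K (λ k → f k ^ ∑ L (λ l → mult k (g l)))
∏∏-by-multiplicity K L g f u cover = begin
    ∏ L (λ l → ∏ (g l) f)
  ≡⟨ ∏-cong L (λ l l∈ → ∏-by-multiplicity K (g l) f u (cover l l∈)) ⟩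
    ∏ L (λ l → ∏ K (λ k → f k ^ mult k (g l)))
  ≡⟨ ∏-swap L K (λ l k → f k ^ mult k (g l)) ⟩
    ∏ K (λ k → ∏ L (λ l → f k ^ mult k (g l)))
  ≡⟨ ∏-cong K (λ k _ → ∏-^-exponent L (f k) (λ l → mult k (g l))) ⟩
    ∏ K (λ k → f k ^ ∑ L (λ l → mult k (g l))) ∎
  where open ≡-Reasoning

∏-exponent-exchange : (K M : List ℕ) (f e : ℕ → ℕ) (c : ℕ → ℕ → ℕ) →
  ∏ K (λ k → f k ^ ∑ M (λ m → c k m * e m)) ≡ ∏ M (λ m → ∏ K (λ k → f k ^ c k m) ^ e m)
∏-exponent-exchange K M f e c = begin
    ∏ K (λ k → f k ^ ∑ M (λ m → c k m * e m))
  ≡⟨ ∏-cong K (λ k _ → sym (∏-^-exponent M (f k) (λ m → c k m * e m))) ⟩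
    ∏ K (λ k → ∏ M (λ m → f k ^ (c k m * e m)))
  ≡⟨ ∏-cong K (λ k _ → ∏-cong M (λ m _ → sym (^-*-assoc (f k) (c k m) (e m)))) ⟩
    ∏ K (λ k → ∏ M (λ m → (f k ^ c k m) ^ e m))
  ≡⟨ ∏-swap K M (λ k m → (f k ^ c k m) ^ e m) ⟩
    ∏ M (λ m → ∏ K (λ k → (f k ^ c k m) ^ e m))
  ≡⟨ ∏-cong M (λ m _ → ∏-^-base K (λ k → f k ^ c k m) (e m)) ⟩
    ∏ M (λ m → ∏ K (λ k → f k ^ c k m) ^ e m) ∎
  where open ≡-Reasoning

range : ℕ → List ℕ
range n = applyUpTo suc n

range-unique : ∀ n → Unique (range n)
range-unique n = Unique.applyUpTo⁺₁ suc n (λ i<j _ eq → <⇒≢ i<j (suc-injective eq))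

∈-range⁺ : ∀ {n x} → 1 ≤ x → x ≤ n → x ∈ range n
∈-range⁺ {n} {suc i} _ i<n = ∈-applyUpTo⁺ suc i<n

∈-range⁻ : ∀ {n x} → x ∈ range n → 1 ≤ x × x ≤ n
∈-range⁻ x∈ with ∈-applyUpTo⁻ suc x∈
... | i , i<n , refl = s≤s z≤n , i<n

∑-applyUpTo-+ : ∀ (f : ℕ → A) a b (g : A → ℕ) →
  ∑ (applyUpTo f (a + b)) g ≡ ∑ (applyUpTo f a) g + ∑ (applyUpTo (λ j → f (a + j)) b) g
∑-applyUpTo-+ f zero    b g = refl
∑-applyUpTo-+ f (suc a) b g =
  trans (cong (g (f 0) +_) (∑-applyUpTo-+ (λ j → f (suc j)) a b g)) (sym (+-assoc (g (f 0)) _ _))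

∑-applyUpTo-cong : ∀ {f f′ : ℕ → A} n {g h : A → ℕ} → (∀ j → g (f j) ≡ h (f′ j)) →
  ∑ (applyUpTo f n) g ≡ ∑ (applyUpTo f′ n) h
∑-applyUpTo-cong zero    _ = refl
∑-applyUpTo-cong (suc n) e = cong₂ _+_ (e 0) (∑-applyUpTo-cong n (λ j → e (suc j)))

∈⇒≤sum : ∀ {x} (l : List ℕ) → x ∈ l → x ≤ sum l
∈⇒≤sum (y ∷ l) (here refl) = m≤m+n y (sum l)
∈⇒≤sum (y ∷ l) (there x∈)  = ≤-trans (∈⇒≤sum l x∈) (m≤n+m (sum l) y)

part∈range : ∀ {n l x} → IsPartition n l → x ∈ l → x ∈ range n
part∈range {l = l} (pos , _ , sum≡n) x∈ = ∈-range⁺ (All.lookup pos x∈) (subst (_ ≤_) sum≡n (∈⇒≤sum l x∈))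

-- Partitions are listed in non-increasing order: sorted for the reversed order ≥.
≥-decTotalOrder : DecTotalOrder _ _ _
≥-decTotalOrder = Flip.decTotalOrder ≤-decTotalOrder

sorted-↭⇒≡ : {xs ys : List ℕ} → Linked _≥_ xs → Linked _≥_ ys → xs ↭ ys → xs ≡ ys
sorted-↭⇒≡ xs↘ ys↘ xs↭ys = ≋⇒≡ (↗↭↗⇒≋ (DecTotalOrder.totalOrder ≥-decTotalOrder) xs↘ ys↘ (↭⇒↭ₛ xs↭ys))

insertPart : ℕ → List ℕ → List ℕ
insertPart = insert ≥-decTotalOrder

insertPart-↭ : ∀ k l → insertPart k l ↭ k ∷ l
insertPart-↭ = InsertionSort.insert-↭ ≥-decTotalOrder

∈-insertPart : ∀ k l → k ∈ insertPart k l
∈-insertPart k l = Perm.∈-resp-↭ (↭-sym (insertPart-↭ k l)) (here refl)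

mult-insertPart : ∀ k l → mult k (insertPart k l) ≡ suc (mult k l)
mult-insertPart k l = trans (∑-↭ _ (insertPart-↭ k l)) (cong (_+ mult k l) (𝟙-yes (k ≟ k) refl))

removePart : ℕ → List ℕ → List ℕ
removePart k []       = []
removePart k (x ∷ xs) with k ≟ x
... | yes _ = xs
... | no _  = x ∷ removePart k xs

removePart-↭ : ∀ {k} l → k ∈ l → l ↭ k ∷ removePart k l
removePart-↭ {k} (x ∷ xs) k∈ with k ≟ x | k∈
... | yes refl | _          = ↭-refl
... | no k≢x   | here k≡x   = contradiction k≡x k≢x
... | no _     | there k∈xs = ↭-trans (↭-prep x (removePart-↭ xs k∈xs)) (↭-swap x k ↭-refl)

removePart-sorted : ∀ k l → Linked _≥_ l → Linked _≥_ (removePart k l)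
removePart-sorted k []       _ = []
removePart-sorted k (x ∷ xs) s with k ≟ x
... | yes _ = Linked.tail s
... | no _  = belowHead xs s
  where
  belowHead : ∀ {x} ys → Linked _≥_ (x ∷ ys) → Linked _≥_ (x ∷ removePart k ys)
  belowHead []       _ = [-]
  belowHead (y ∷ ys) (x≥y ∷ s) with k ≟ y
  belowHead (y ∷ [])     (x≥y ∷ _)         | yes _ = [-]
  belowHead (y ∷ z ∷ zs) (x≥y ∷ (y≥z ∷ s)) | yes _ = ≤-trans y≥z x≥y ∷ s
  ... | no _ = x≥y ∷ belowHead ys s

insertPart-partition : ∀ {k m l} → 1 ≤ k → IsPartition m l → IsPartition (k + m) (insertPart k l)
insertPart-partition {k} {m} {l} 1≤k (pos , l↘ , sum≡m) =
  Perm.All-resp-↭ (↭-sym (insertPart-↭ k l)) (1≤k ∷ pos) ,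
  InsertionSort.insert-↗ ≥-decTotalOrder k l↘ ,
  trans (sum-↭ (insertPart-↭ k l)) (cong (k +_) sum≡m)

removePart-partition : ∀ {k n l} → IsPartition n l → k ∈ l → IsPartition (n ∸ k) (removePart k l)
removePart-partition {k} {n} {l} (pos , l↘ , sum≡n) k∈l =
  All.tail (Perm.All-resp-↭ (removePart-↭ l k∈l) pos) ,
  removePart-sorted k l l↘ ,
  trans (sym (m+n∸m≡n k _)) (cong (_∸ k) (trans (sym (sum-↭ (removePart-↭ l k∈l))) sum≡n))

insertPart-removePart : ∀ {k l} → Linked _≥_ l → k ∈ l → insertPart k (removePart k l) ≡ l
insertPart-removePart {k} {l} l↘ k∈l =
  sorted-↭⇒≡ (InsertionSort.insert-↗ ≥-decTotalOrder k (removePart-sorted k l l↘)) l↘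
             (↭-trans (insertPart-↭ k _) (↭-sym (removePart-↭ l k∈l)))

insertPart-injective : ∀ {k a b} → Linked _≥_ a → Linked _≥_ b → insertPart k a ≡ insertPart k b → a ≡ b
insertPart-injective {k} {a} {b} a↘ b↘ eq = sorted-↭⇒≡ a↘ b↘
  (Perm.drop-∷ (↭-trans (↭-sym (insertPart-↭ k a)) (↭-trans (↭-reflexive eq) (insertPart-↭ k b))))

module PartitionCounting (P : ℕ → List (List ℕ)) (enumerates : EnumeratesPartitions P) where

  p : ℕ → ℕ
  p m = length (P m)

  isPartition : ∀ {m l} → l ∈ P m → IsPartition m l
  isPartition {m} {l} = Equivalence.to (proj₁ enumerates m l)

  listed : ∀ {m l} → IsPartition m l → l ∈ P m
  listed {m} {l} = Equivalence.from (proj₁ enumerates m l)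

  parts∈range : ∀ {n l x} → l ∈ P n → x ∈ l → x ∈ range n
  parts∈range l∈ = part∈range (isPartition l∈)

  containing↭inserted : ∀ {n k} → 1 ≤ k → k ≤ n → filter (k ∈?_) (P n) ↭ map (insertPart k) (P (n ∸ k))
  containing↭inserted {n} {k} 1≤k k≤n = ∼bag⇒↭ (unique∧set⇒bag
    (Unique.filter⁺ (k ∈?_) (proj₂ enumerates n))
    (unique-map (P (n ∸ k)) injective (proj₂ enumerates (n ∸ k)))
    (mk⇔ remove reinsert))
    where
    injective : ∀ {a b} → a ∈ P (n ∸ k) → b ∈ P (n ∸ k) → insertPart k a ≡ insertPart k b → a ≡ b
    injective a∈ b∈ = insertPart-injective (proj₁ (proj₂ (isPartition a∈))) (proj₁ (proj₂ (isPartition b∈)))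
    remove : ∀ {l} → l ∈ filter (k ∈?_) (P n) → l ∈ map (insertPart k) (P (n ∸ k))
    remove {l} l∈ with ∈-filter⁻ (k ∈?_) l∈
    ... | l∈P , k∈l = subst (_∈ map (insertPart k) (P (n ∸ k)))
                            (insertPart-removePart (proj₁ (proj₂ (isPartition l∈P))) k∈l)
                            (∈-map⁺ (insertPart k) (listed (removePart-partition (isPartition l∈P) k∈l)))
    reinsert : ∀ {l} → l ∈ map (insertPart k) (P (n ∸ k)) → l ∈ filter (k ∈?_) (P n)
    reinsert l∈ with ∈-map⁻ (insertPart k) l∈
    ... | μ , μ∈ , refl = ∈-filter⁺ (k ∈?_)
      (listed (subst (λ m → IsPartition m (insertPart k μ)) (m+[n∸m]≡n k≤n) (insertPart-partition 1≤k (isPartition μ∈))))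
      (∈-insertPart k μ)

  distinctMult : ∀ {n k} → 1 ≤ k → k ≤ n → ∑ (P n) (λ l → mult k (deduplicate _≟_ l)) ≡ p (n ∸ k)
  distinctMult {n} {k} 1≤k k≤n = begin
      ∑ (P n) (λ l → mult k (deduplicate _≟_ l))
    ≡⟨ ∑-cong (P n) (λ l _ → mult-deduplicate k l) ⟩
      ∑ (P n) (λ l → 𝟙 (k ∈? l))
    ≡⟨ ∑-𝟙 (k ∈?_) (P n) ⟩
      length (filter (k ∈?_) (P n))
    ≡⟨ Perm.↭-length (containing↭inserted 1≤k k≤n) ⟩
      length (map (insertPart k) (P (n ∸ k)))
    ≡⟨ length-map (insertPart k) (P (n ∸ k)) ⟩
      p (n ∸ k) ∎
    where open ≡-Reasoning

  totalMult : ℕ → ℕ → ℕ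
  totalMult k n = ∑ (P n) (mult k)

  totalMult-small : ∀ {k n} → n < k → totalMult k n ≡ 0
  totalMult-small {k} {n} n<k = ∑-zero (P n) λ l l∈ → mult-∉ k l λ k∈l →
    <⇒≱ n<k (subst (k ≤_) (proj₂ (proj₂ (isPartition l∈))) (∈⇒≤sum l k∈l))

  -- Each partition of k + r containing k comes from a partition of r by
  -- inserting one more copy of k.
  totalMult-step : ∀ {k} r → 1 ≤ k → totalMult k (k + r) ≡ p r + totalMult k r
  totalMult-step {k} r 1≤k = begin
      ∑ (P (k + r)) (mult k)
    ≡⟨ ∑-filter (k ∈?_) (P (k + r)) (mult k) (mult-∉ k) ⟩
      ∑ (filter (k ∈?_) (P (k + r))) (mult k)
    ≡⟨ ∑-↭ (mult k) (containing↭inserted 1≤k (m≤m+n k r)) ⟩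
      ∑ (map (insertPart k) (P (k + r ∸ k))) (mult k)
    ≡⟨ cong (λ m → ∑ (map (insertPart k) (P m)) (mult k)) (m+n∸m≡n k r) ⟩
      ∑ (map (insertPart k) (P r)) (mult k)
    ≡⟨ oneMore (P r) ⟩
      p r + totalMult k r ∎
    where
    open ≡-Reasoning
    oneMore : (L : List (List ℕ)) → ∑ (map (insertPart k) L) (mult k) ≡ length L + ∑ L (mult k)
    oneMore []      = refl
    oneMore (μ ∷ L) = trans (cong₂ _+_ (mult-insertPart k μ) (oneMore L))
                            (cong suc (x∙yz≈y∙xz (mult k μ) (length L) (∑ L (mult k))))

  divisorWeighted : ℕ → ℕ → ℕ
  divisorWeighted k n = ∑ (range n) (λ m → 𝟙 (k ∣? m) * p (n ∸ m))

  divisorWeighted-small : ∀ {k n} → n < k → divisorWeighted k n ≡ 0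
  divisorWeighted-small {k} {n} n<k = ∑-zero (range n) λ m m∈ →
    cong (_* p (n ∸ m)) (𝟙-no (k ∣? m) λ k∣m →
      <⇒≱ (≤-<-trans (proj₂ (∈-range⁻ m∈)) n<k) (∣⇒≤′ (proj₁ (∈-range⁻ m∈)) k∣m))

  -- The same recursion holds for the divisor-weighted count: among m ≤ k only
  -- m = k is divisible by k, and shifting m by k preserves divisibility by k.
  divisorWeighted-step : ∀ {k} r → 1 ≤ k → divisorWeighted k (k + r) ≡ p r + divisorWeighted k r
  divisorWeighted-step {suc k′} r _ = begin
      ∑ (range (k + r)) g
    ≡⟨ ∑-applyUpTo-+ suc k r g ⟩
      ∑ (range k) g + ∑ (applyUpTo (λ j → suc (k + j)) r) g
    ≡⟨ cong₂ _+_ firstBlock (∑-applyUpTo-cong r shifted) ⟩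
      p r + divisorWeighted k r ∎
    where
    open ≡-Reasoning
    k = suc k′
    g : ℕ → ℕ
    g m = 𝟙 (k ∣? m) * p (k + r ∸ m)
    belowK : ∀ m → m ∈ range k′ → g m ≡ 0
    belowK m m∈ = cong (_* p (k + r ∸ m)) (𝟙-no (k ∣? m) λ k∣m →
      <⇒≱ (s≤s (proj₂ (∈-range⁻ m∈))) (∣⇒≤′ (proj₁ (∈-range⁻ m∈)) k∣m))
    firstBlock : ∑ (range k) g ≡ p r
    firstBlock = begin
        ∑ (range k) g
      ≡⟨ cong (λ L → ∑ L g) (sym (applyUpTo-∷ʳ suc k′)) ⟩
        ∑ (range k′ ++ [ k ]) g
      ≡⟨ ∑-++ (range k′) [ k ] g ⟩
        ∑ (range k′) g + (g k + 0)
      ≡⟨ cong₂ _+_ (∑-zero (range k′) belowK) (+-identityʳ (g k)) ⟩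
        g k
      ≡⟨ cong₂ _*_ (𝟙-yes (k ∣? k) ∣-refl) (cong p (m+n∸m≡n k r)) ⟩
        1 * p r
      ≡⟨ *-identityˡ (p r) ⟩
        p r ∎
    shifted : ∀ j → g (suc (k + j)) ≡ 𝟙 (k ∣? suc j) * p (r ∸ suc j)
    shifted j = cong₂ _*_
      (𝟙-⇔ (λ k∣ → ∣m+n∣m⇒∣n (subst (k ∣_) (sym (+-suc k j)) k∣) ∣-refl)
           (λ k∣ → subst (k ∣_) (+-suc k j) (∣m∣n⇒∣m+n ∣-refl k∣))
           (k ∣? suc (k + j)) (k ∣? suc j))
      (cong p (trans (cong (k + r ∸_) (sym (+-suc k j))) ([m+n]∸[m+o]≡n∸o k r (suc j))))

  totalMult≡divisorWeighted : ∀ {k} → 1 ≤ k → ∀ n → totalMult k n ≡ divisorWeighted k n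
  totalMult≡divisorWeighted {k} 1≤k = <-rec (λ n → totalMult k n ≡ divisorWeighted k n) step
    where
    step : ∀ n → (∀ {m} → m < n → totalMult k m ≡ divisorWeighted k m) → totalMult k n ≡ divisorWeighted k n
    step n ih with k ≤? n
    ... | no k≰n  = trans (totalMult-small (≰⇒> k≰n)) (sym (divisorWeighted-small (≰⇒> k≰n)))
    ... | yes k≤n = subst (λ m → totalMult k m ≡ divisorWeighted k m) (m+[n∸m]≡n k≤n) (begin
        totalMult k (k + r)         ≡⟨ totalMult-step r 1≤k ⟩
        p r + totalMult k r         ≡⟨ cong (p r +_) (ih (∸-monoʳ-< 1≤k k≤n)) ⟩
        p r + divisorWeighted k r   ≡⟨ divisorWeighted-step r 1≤k ⟨
        divisorWeighted k (k + r)   ∎)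
      where
      open ≡-Reasoning
      r = n ∸ k

IsPrimePower : ℕ → Set
IsPrimePower y = ∃₂ λ q b → Prime q × y ≡ q ^ suc b

prime>1 : ∀ {q} → Prime q → 1 < q
prime>1 {q} q-prime = nonTrivial⇒n>1 q ⦃ prime⇒nonTrivial q-prime ⦄

primeFactor : ∀ m → ∃ λ q → Prime q × q ∣ suc (suc m)
primeFactor m with factorise (suc (suc m))
... | record { factors = [] ; isFactorisation = () }
... | record { factors = q ∷ qs ; isFactorisation = eq ; factorsPrime = q-prime ∷ _ } =
  q , q-prime , divides (product qs) (trans eq (*-comm q (product qs)))

cofactor-bounds : ∀ {c q m} → 1 < q → 1 ≤ m → m ≡ c * q → 1 ≤ c × c < m
cofactor-bounds {zero}  _   ()  refl
cofactor-bounds {suc c} 1<q _   refl = s≤s z≤n , m<m*n (suc c) _ 1<q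

^-monoʳ-∣ : ∀ q {a b} → a ≤ b → q ^ a ∣ q ^ b
^-monoʳ-∣ q {a} {b} a≤b = divides (q ^ (b ∸ a)) (begin
    q ^ b               ≡⟨ cong (q ^_) (m+[n∸m]≡n a≤b) ⟨
    q ^ (a + (b ∸ a))   ≡⟨ ^-distribˡ-+-* q a (b ∸ a) ⟩
    q ^ a * q ^ (b ∸ a) ≡⟨ *-comm (q ^ a) (q ^ (b ∸ a)) ⟩
    q ^ (b ∸ a) * q ^ a ∎)
  where open ≡-Reasoning

prime∣prime^⇒≡ : ∀ {p q} → Prime p → Prime q → ∀ n → p ∣ q ^ n → p ≡ q
prime∣prime^⇒≡ p-prime q-prime zero    p∣1 = contradiction (subst Prime (∣1⇒≡1 p∣1) p-prime) ¬prime[1]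
prime∣prime^⇒≡ {q = q} p-prime q-prime (suc n) p∣qqⁿ with euclidsLemma q (q ^ n) p-prime p∣qqⁿ
... | inj₂ p∣qⁿ = prime∣prime^⇒≡ p-prime q-prime n p∣qⁿ
... | inj₁ p∣q with prime⇒irreducible q-prime p∣q
...   | inj₁ p≡1 = contradiction (subst Prime p≡1 p-prime) ¬prime[1]
...   | inj₂ p≡q = p≡q

prime^-coprime : ∀ {p q} → Prime p → Prime q → q ≢ p → ∀ b → Coprime (q ^ b) p
prime^-coprime p-prime q-prime q≢p b (d∣qᵇ , d∣p) with prime⇒irreducible p-prime d∣p
... | inj₁ d≡1 = d≡1
... | inj₂ refl = contradiction (sym (prime∣prime^⇒≡ p-prime q-prime b d∣qᵇ)) q≢p

valuation : ∀ {p} → Prime p → ∀ m → 1 ≤ m → ∃ λ v → p ^ v ∣ m × ¬ (p ^ suc v ∣ m)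
valuation {p} p-prime = <-rec (λ m → 1 ≤ m → ∃ λ v → p ^ v ∣ m × ¬ (p ^ suc v ∣ m)) step
  where
  instance
    p≢0 = prime⇒nonZero p-prime
  step : ∀ m → (∀ {c} → c < m → 1 ≤ c → ∃ λ v → p ^ v ∣ c × ¬ (p ^ suc v ∣ c)) →
         1 ≤ m → ∃ λ v → p ^ v ∣ m × ¬ (p ^ suc v ∣ m)
  step m ih 1≤m with p ∣? m
  ... | no p∤m = 0 , 1∣ m , λ p¹∣m → p∤m (subst (_∣ m) (*-identityʳ p) p¹∣m)
  ... | yes (divides c m≡cp) with cofactor-bounds (prime>1 p-prime) 1≤m m≡cp
  ...   | 1≤c , c<m with ih c<m 1≤c
  ...     | v , pᵛ∣c , pᵛ⁺¹∤c =
    suc v , subst (p ^ suc v ∣_) pc≡m (*-monoʳ-∣ p pᵛ∣c) ,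
    λ pᵛ⁺²∣m → pᵛ⁺¹∤c (*-cancelˡ-∣ p (subst (p ^ suc (suc v) ∣_) (sym pc≡m) pᵛ⁺²∣m))
    where
    pc≡m : p * c ≡ m
    pc≡m = trans (*-comm p c) (sym m≡cp)

newPrimePower : ∀ {p v c y} → Prime p → p ^ v ∣ c → ¬ (p ^ suc v ∣ c) →
  y ∣ p * c → ¬ (y ∣ c) → IsPrimePower y → y ≡ p ^ suc v
newPrimePower {p} {v} p-prime pᵛ∣c pᵛ⁺¹∤c y∣pc y∤c (q , b , q-prime , refl) with q ≟ p
... | no q≢p = contradiction (coprime-divisor (prime^-coprime p-prime q-prime q≢p (suc b)) y∣pc) y∤c
... | yes refl with <-cmp b v
...   | tri< b<v _ _ = contradiction (∣-trans (^-monoʳ-∣ q b<v) pᵛ∣c) y∤c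
...   | tri≈ _ refl _ = refl
...   | tri> _ _ v<b = contradiction (∣-trans (^-monoʳ-∣ q v<b) (*-cancelˡ-∣ q ⦃ prime⇒nonZero q-prime ⦄ y∣pc)) pᵛ⁺¹∤c

module VonMangoldt (E : ℕ → ℕ) (isExpΛ : IsExpVonMangoldt E) where

  E-primePower : ∀ {q b} → Prime q → E (q ^ suc b) ≡ q
  E-primePower {q} {b} q-prime = proj₁ isExpΛ q b q-prime

  E-other : ∀ {y} → ¬ IsPrimePower y → E y ≡ 1
  E-other = proj₂ isExpΛ _

  -- 1 is not a prime power.
  E-1 : E 1 ≡ 1
  E-1 = E-other λ (q , b , q-prime , 1≡qᵇ⁺¹) →
    ¬prime[1] (subst Prime (∣1⇒≡1 (subst (q ∣_) (sym 1≡qᵇ⁺¹) (m∣m*n (q ^ b)))) q-prime)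

  divisorProduct : ℕ → ℕ → ℕ
  divisorProduct N m = ∏ (range N) (λ d → E d ^ 𝟙 (d ∣? m))

  divisorProduct-1 : ∀ N → divisorProduct N 1 ≡ 1
  divisorProduct-1 N = ∏-one (range N) onlyOne
    where
    onlyOne : ∀ d → d ∈ range N → E d ^ 𝟙 (d ∣? 1) ≡ 1
    onlyOne d _ with d ∣? 1
    ... | yes d∣1 = trans (*-identityʳ (E d)) (trans (cong E (∣1⇒≡1 d∣1)) E-1)
    ... | no _    = refl

  -- Passing from c to p·c adds exactly one divisor d with exp Λ(d) ≠ 1,
  -- namely p^(1+v) for the valuation v of p in c, and it contributes p.
  divisorProduct-step : ∀ {N p c} → Prime p → 1 ≤ c → p * c ≤ N →
    divisorProduct N (p * c) ≡ divisorProduct N c * p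
  divisorProduct-step {N} {p} {c} p-prime 1≤c pc≤N = begin
      divisorProduct N (p * c)
    ≡⟨ ∏-cong (range N) (λ d _ → trans (cong (E d ^_) (𝟙-split (λ d∣c → ∣-trans d∣c (n∣m*n p)) (d ∣? p * c) (d ∣? c)))
                                        (^-distribˡ-+-* (E d) (𝟙 (d ∣? c)) _)) ⟩
      ∏ (range N) (λ d → E d ^ 𝟙 (d ∣? c) * E d ^ 𝟙 (d ∣? p * c ×-dec ¬? (d ∣? c)))
    ≡⟨ ∏-* (range N) _ _ ⟩
      divisorProduct N c * ∏ (range N) (λ d → E d ^ 𝟙 (d ∣? p * c ×-dec ¬? (d ∣? c)))
    ≡⟨ cong (divisorProduct N c *_) newFactor ⟩
      divisorProduct N c * p ∎
    where
    open ≡-Reasoning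
    instance
      p≢0 = prime⇒nonZero p-prime
    newFactor : ∏ (range N) (λ d → E d ^ 𝟙 (d ∣? p * c ×-dec ¬? (d ∣? c))) ≡ p
    newFactor with valuation p-prime c 1≤c
    ... | v , pᵛ∣c , pᵛ⁺¹∤c = trans (∏-single (range N) (range-unique N) x∈range others) atX
      where
      x = p ^ suc v
      x∣pc : x ∣ p * c
      x∣pc = *-monoʳ-∣ p pᵛ∣c
      x∈range : x ∈ range N
      x∈range = ∈-range⁺ (m^n>0 p (suc v)) (≤-trans (∣⇒≤′ (≤-trans 1≤c (m≤n*m c p)) x∣pc) pc≤N)
      others : ∀ d → d ∈ range N → d ≢ x → E d ^ 𝟙 (d ∣? p * c ×-dec ¬? (d ∣? c)) ≡ 1
      others d _ d≢x with d ∣? p * c | d ∣? c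
      ... | yes d∣pc | no d∤c = trans (*-identityʳ (E d))
                                      (E-other (λ d-pp → d≢x (newPrimePower {v = v} p-prime pᵛ∣c pᵛ⁺¹∤c d∣pc d∤c d-pp)))
      ... | yes _    | yes _  = refl
      ... | no _     | _      = refl
      atX : E x ^ 𝟙 (x ∣? p * c ×-dec ¬? (x ∣? c)) ≡ p
      atX = trans (cong (E x ^_) (𝟙-yes (x ∣? p * c ×-dec ¬? (x ∣? c)) (x∣pc , pᵛ⁺¹∤c)))
                  (trans (*-identityʳ (E x)) (E-primePower {b = v} p-prime))

  divisorProduct≡ : ∀ N m → 1 ≤ m → m ≤ N → divisorProduct N m ≡ m
  divisorProduct≡ N = <-rec (λ m → 1 ≤ m → m ≤ N → divisorProduct N m ≡ m) step
    where
    step : ∀ m → (∀ {c} → c < m → 1 ≤ c → c ≤ N → divisorProduct N c ≡ c) →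
           1 ≤ m → m ≤ N → divisorProduct N m ≡ m
    step (suc zero)    _  _   _   = divisorProduct-1 N
    step (suc (suc m)) ih 1≤M M≤N with primeFactor m
    ... | q , q-prime , divides c M≡cq with cofactor-bounds (prime>1 q-prime) 1≤M M≡cq
    ...   | 1≤c , c<M = begin
        divisorProduct N (suc (suc m)) ≡⟨ cong (divisorProduct N) M≡qc ⟩
        divisorProduct N (q * c)       ≡⟨ divisorProduct-step q-prime 1≤c (subst (_≤ N) M≡qc M≤N) ⟩
        divisorProduct N c * q         ≡⟨ cong (_* q) (ih c<M 1≤c (≤-trans (<⇒≤ c<M) M≤N)) ⟩
        c * q                          ≡⟨ M≡cq ⟨
        suc (suc m)                    ∎
      where
      open ≡-Reasoning
      M≡qc : suc (suc m) ≡ q * c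
      M≡qc = trans M≡cq (*-comm c q)

corollary11 : (n : ℕ) → 1 ≤ n →
    (P : ℕ → List (List ℕ)) → EnumeratesPartitions P →
    (E : ℕ → ℕ) → IsExpVonMangoldt E →
    (prodExpΛ P E n ≡ prodAllDistinct P n) × (prodAllDistinct P n ≡ prodKPow P n)
corollary11 n _ P enumerates E isExpΛ = trans viaVonMangoldt (sym viaDistinctParts) , viaDistinctParts
  where
  open PartitionCounting P enumerates
  open VonMangoldt E isExpΛ
  open ≡-Reasoning
  viaDistinctParts : prodAllDistinct P n ≡ prodKPow P n
  viaDistinctParts = begin
      ∏ (P n) (λ l → product (deduplicate _≟_ l))
    ≡⟨ ∏-cong (P n) (λ l _ → cong product (sym (map-id (deduplicate _≟_ l)))) ⟩
      ∏ (P n) (λ l → ∏ (deduplicate _≟_ l) (λ k → k))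
    ≡⟨ ∏∏-by-multiplicity (range n) (P n) (deduplicate _≟_) (λ k → k) (range-unique n)
         (λ l l∈ x x∈ → parts∈range l∈ (∈-deduplicate⁻ _≟_ l x∈)) ⟩
      ∏ (range n) (λ k → k ^ ∑ (P n) (λ l → mult k (deduplicate _≟_ l)))
    ≡⟨ ∏-cong (range n) (λ k k∈ → cong (k ^_) (distinctMult (proj₁ (∈-range⁻ k∈)) (proj₂ (∈-range⁻ k∈)))) ⟩
      ∏ (range n) (λ k → k ^ p (n ∸ k)) ∎
  viaVonMangoldt : prodExpΛ P E n ≡ prodKPow P n
  viaVonMangoldt = begin
      ∏ (P n) (λ l → ∏ l E)
    ≡⟨ ∏∏-by-multiplicity (range n) (P n) (λ l → l) E (range-unique n) (λ l l∈ x → parts∈range l∈) ⟩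
      ∏ (range n) (λ k → E k ^ totalMult k n)
    ≡⟨ ∏-cong (range n) (λ k k∈ → cong (E k ^_) (totalMult≡divisorWeighted (proj₁ (∈-range⁻ k∈)) n)) ⟩
      ∏ (range n) (λ k → E k ^ divisorWeighted k n)
    ≡⟨ ∏-exponent-exchange (range n) (range n) E (λ m → p (n ∸ m)) (λ k m → 𝟙 (k ∣? m)) ⟩
      ∏ (range n) (λ m → divisorProduct n m ^ p (n ∸ m))
    ≡⟨ ∏-cong (range n) (λ m m∈ → cong (_^ p (n ∸ m)) (divisorProduct≡ n m (proj₁ (∈-range⁻ m∈)) (proj₂ (∈-range⁻ m∈)))) ⟩
      ∏ (range n) (λ m → m ^ p (n ∸ m)) ∎
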